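{- Let $G$ be a connected graph and $H=G_\ell$ its $\ell$-subdivision for some integer $\ell\ge1$. Let $P$ be an isometric path of $H$ between two original vertices $u,v$, and let $w$ be an original vertex with $d_H(w,V(P))<(r+1)\ell$ for some positive integer $r$. Then for $Q=G(P)$ we have $d_G(w,V(Q))\le r$.
   Context: The $\ell$-subdivision $G_\ell$ of $G$ is obtained by replacing every edge of $G$ by a path of length $\ell$; the vertices of $G$ in $G_\ell$ are called original vertices. $d_H,d_G$ are shortest-path distances. For an isometric (shortest) path $P$ of $H=G_\ell$ between two original vertices $u,v$, $G(P)$ denotes the isometric $(u,v)$-path of $G$ whose $\ell$-subdivision is $P$. -}

module Defs where

open import Data.Nat using (ℕ; zero; suc; _≤_; _<_; _∸_)
open import Data.Fin using (Fin; toℕ)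
open import Data.Bool using (Bool; true; false)
open import Data.Sum using (_⊎_; inj₁; inj₂)
open import Data.Product using (Σ; ∃; _×_; _,_; proj₁)
open import Data.List using (List; []; _∷_; length)
open import Data.Maybe using (Maybe; just; nothing)
open import Data.List using (mapMaybe)
open import Data.List.Relation.Unary.Unique.Propositional using (Unique)
open import Relation.Binary.PropositionalEquality using (_≡_)

record Graph : Set where
  field
    n      : ℕ
    adj    : Fin n → Fin n → Bool
    sym    : ∀ x y → adj x y ≡ adj y x
    irrefl : ∀ x → adj x x ≡ false

module _ {V : Set} (R : V → V → Set) where
  data Walk : V → V → ℕ → Set where
    []  : ∀ {x} → Walk x x 0
    _∷_ : ∀ {x y z k} → R x y → Walk y z k → Walk x z (suc k)

  data Chain : V → List V → V → Set where
    single : ∀ {x} → Chain x (x ∷ []) x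
    cons   : ∀ {x y ys z} → R x y → Chain y (y ∷ ys) z → Chain x (x ∷ y ∷ ys) z

  IsPath : V → V → List V → Set
  IsPath x y p = Chain x p y × Unique p

  IsIsometricPath : V → V → List V → Set
  IsIsometricPath x y p = IsPath x y p × (∀ m → Walk x y m → length p ∸ 1 ≤ m)

  Connected : Set
  Connected = ∀ x y → ∃ λ k → Walk x y k

module _ (G : Graph) where
  open Graph G

  V : Set
  V = Fin n

  Adj : V → V → Set
  Adj x y = adj x y ≡ true

  Edge : Set
  Edge = Σ V λ a → Σ V λ b → (toℕ a < toℕ b) × Adj a b

  src tgt : Edge → V
  src (a , _) = a
  tgt (_ , b , _) = b

  -- vertices of the ℓ-subdivision: original vertices, plus for each edge e
  -- the ℓ-1 internal vertices (e , i), i = 0 .. ℓ-2, counted from src e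
  SubV : ℕ → Set
  SubV ℓ = V ⊎ (Edge × Fin (ℓ ∸ 1))

  data SubStep (ℓ : ℕ) : SubV ℓ → SubV ℓ → Set where
    direct : (e : Edge) → ℓ ≡ 1 → SubStep ℓ (inj₁ (src e)) (inj₁ (tgt e))
    enter  : (e : Edge) (i : Fin (ℓ ∸ 1)) → toℕ i ≡ 0 →
             SubStep ℓ (inj₁ (src e)) (inj₂ (e , i))
    along  : (e : Edge) (i j : Fin (ℓ ∸ 1)) → toℕ j ≡ suc (toℕ i) →
             SubStep ℓ (inj₂ (e , i)) (inj₂ (e , j))
    leave  : (e : Edge) (i : Fin (ℓ ∸ 1)) → suc (toℕ i) ≡ ℓ ∸ 1 →
             SubStep ℓ (inj₂ (e , i)) (inj₁ (tgt e))

  SubAdj : (ℓ : ℕ) → SubV ℓ → SubV ℓ → Set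
  SubAdj ℓ x y = SubStep ℓ x y ⊎ SubStep ℓ y x

  origOf : (ℓ : ℕ) → SubV ℓ → Maybe V
  origOf ℓ (inj₁ x) = just x
  origOf ℓ (inj₂ _) = nothing

  -- G(P): for an isometric path P of G_ℓ between original vertices,
  -- the path of G whose ℓ-subdivision is P (its vertex sequence is the
  -- sequence of original vertices on P)
  GOf : (ℓ : ℕ) → List (SubV ℓ) → List V
  GOf ℓ = mapMaybe (origOf ℓ)

-- Project a walk of G_ℓ from a vertex p to the original vertex w onto G: every vertex of G_ℓ has
-- at most two anchors (itself, or the two ends of the edge whose interior it lies in), and walking
-- backwards from w we can keep track of an anchor a of the current vertex and a walk of G from a
-- to w whose length k satisfies k ℓ + d ≤ m, where d is the distance to the anchor and m the
-- length walked so far. A path of G_ℓ between original vertices that meets the interior of an edge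
-- must traverse the whole edge, so every anchor of a vertex of P is a vertex of G(P); with
-- k ℓ ≤ m < (r + 1) ℓ this gives k ≤ r.
module Submission where

open import Defs
open import Data.Nat using (ℕ; suc; _≤_; _<_; _*_)
open import Data.Product using (∃; _×_)
open import Data.Sum using (inj₁)
open import Data.List using (List)
open import Data.List.Membership.Propositional using (_∈_)

open import Data.Nat using (zero; _+_; _∸_; z≤n; s≤s)
open import Data.Nat.Properties
open import Data.Fin using (toℕ)
open import Data.Fin.Properties using (toℕ-injective; toℕ<n)
open import Data.Product using (∃₂; _,_; proj₁; proj₂)
open import Data.Sum using (inj₂)
open import Data.List using ([]; _∷_)
open import Data.List.Relation.Unary.All using (All; []; _∷_; lookup)
open import Data.List.Relation.Unary.AllPairs using (_∷_)
open import Data.List.Relation.Unary.Any using (here; there)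
import Data.List.Relation.Unary.Any as Any
open import Data.List.Relation.Unary.Any.Properties using (map⁺; mapMaybe⁺)
open import Data.List.Relation.Unary.Unique.Propositional using (Unique)
open import Data.List.Relation.Binary.Subset.Propositional using (_⊆_)
open import Data.Maybe.Relation.Unary.Any using (just)
open import Relation.Binary.PropositionalEquality using (_≡_; refl; sym; trans; cong)
open import Relation.Nullary using (contradiction)

module _ {A : Set} {R : A → A → Set} where

  _++ʷ_ : ∀ {x y z j k} → Walk R x y j → Walk R y z k → Walk R x z (j + k)
  [] ++ʷ V = V
  (s ∷ W) ++ʷ V = s ∷ (W ++ʷ V)

  walk-snoc : ∀ {x y z m} → Walk R x y m → R y z → Walk R x z (suc m)
  walk-snoc [] s = s ∷ []
  walk-snoc (s ∷ W) t = s ∷ walk-snoc W t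

  walk-reverse : (∀ {a b} → R a b → R b a) → ∀ {x y m} → Walk R x y m → Walk R y x m
  walk-reverse sym-R [] = []
  walk-reverse sym-R (s ∷ W) = walk-snoc (walk-reverse sym-R W) (sym-R s)

  chain-head : ∀ {x xs y} → Chain R x xs y → x ∈ xs
  chain-head single = here refl
  chain-head (cons _ _) = here refl

m∸n≤1+m∸[1+n] : ∀ m n → m ∸ n ≤ suc (m ∸ suc n)
m∸n≤1+m∸[1+n] zero zero = z≤n
m∸n≤1+m∸[1+n] zero (suc n) = z≤n
m∸n≤1+m∸[1+n] (suc m) zero = ≤-refl
m∸n≤1+m∸[1+n] (suc m) (suc n) = m∸n≤1+m∸[1+n] m n

module _ (G : Graph) where
  open Graph G renaming (sym to adj-sym)

  Adj-sym : ∀ {a b} → Adj G a b → Adj G b a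
  Adj-sym {a} {b} h = trans (adj-sym b a) h

  edge-adj : (e : Edge G) → Adj G (src G e) (tgt G e)
  edge-adj (_ , _ , _ , h) = h

  module _ (ℓ' : ℕ) where
    private
      ℓ = suc ℓ'
      H = SubAdj G ℓ

    SubAdj-sym : ∀ {x y} → H x y → H y x
    SubAdj-sym (inj₁ s) = inj₂ s
    SubAdj-sym (inj₂ s) = inj₁ s

    -- The internal vertex (e , i) lies at distance i + 1 from src e and ℓ - (i + 1) from tgt e.
    data Anchor : SubV G ℓ → V G → ℕ → Set where
      itself : ∀ {a} → Anchor (inj₁ a) a 0
      at-src : ∀ e i → Anchor (inj₂ (e , i)) (src G e) (suc (toℕ i))
      at-tgt : ∀ e i → Anchor (inj₂ (e , i)) (tgt G e) (ℓ' ∸ toℕ i)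

    AnchorStep : SubV G ℓ → V G → ℕ → Set
    AnchorStep x a' d' = ∃₂ λ a d → Anchor x a d × ∃ λ j → Walk (Adj G) a a' j × j * ℓ + d ≤ suc d'

    stay : ∀ {x a d d'} → Anchor x a d → d ≤ suc d' → AnchorStep x a d'
    stay {d = d} anc d≤1+d' = _ , d , anc , 0 , [] , d≤1+d'

    cross : ∀ {a a' d'} → Adj G a a' → ℓ ≤ suc d' → AnchorStep (inj₁ a) a' d'
    cross adj ℓ≤1+d' =
      _ , 0 , itself , 1 , adj ∷ [] , ≤-trans (≤-reflexive (trans (+-identityʳ (1 * ℓ)) (*-identityˡ ℓ))) ℓ≤1+d'

    anchor-step : ∀ {x x' a' d'} → H x x' → Anchor x' a' d' → AnchorStep x a' d'
    anchor-step (inj₁ (direct e ℓ≡1)) itself = cross (edge-adj e) (≤-reflexive ℓ≡1)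
    anchor-step (inj₁ (enter e i _)) (at-src .e .i) = stay itself z≤n
    anchor-step (inj₁ (enter e i i≡0)) (at-tgt .e .i) =
      cross (edge-adj e) (s≤s (≤-reflexive (cong (ℓ' ∸_) (sym i≡0))))
    anchor-step (inj₁ (along e i j j≡1+i)) (at-src .e .j) =
      stay (at-src e i) (m≤n⇒m≤1+n (s≤s (≤-trans (n≤1+n _) (≤-reflexive (sym j≡1+i)))))
    anchor-step (inj₁ (along e i j j≡1+i)) (at-tgt .e .j) =
      stay (at-tgt e i) (≤-trans (m∸n≤1+m∸[1+n] ℓ' (toℕ i)) (s≤s (≤-reflexive (cong (ℓ' ∸_) (sym j≡1+i)))))
    anchor-step (inj₁ (leave e i 1+i≡ℓ')) itself =
      stay (at-tgt e i) (≤-reflexive (trans (cong (_∸ toℕ i) (sym 1+i≡ℓ')) (m+n∸n≡m 1 (toℕ i))))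
    anchor-step (inj₂ (direct e ℓ≡1)) itself = cross (Adj-sym (edge-adj e)) (≤-reflexive ℓ≡1)
    anchor-step (inj₂ (enter e i i≡0)) itself = stay (at-src e i) (s≤s (≤-reflexive i≡0))
    anchor-step (inj₂ (along e i j j≡1+i)) (at-src .e .i) = stay (at-src e j) (s≤s (≤-reflexive j≡1+i))
    anchor-step (inj₂ (along e i j j≡1+i)) (at-tgt .e .i) =
      stay (at-tgt e j) (m≤n⇒m≤1+n (∸-monoʳ-≤ ℓ' (≤-trans (n≤1+n _) (≤-reflexive (sym j≡1+i)))))
    anchor-step (inj₂ (leave e i 1+i≡ℓ')) (at-src .e .i) =
      cross (Adj-sym (edge-adj e)) (s≤s (≤-reflexive (sym 1+i≡ℓ')))
    anchor-step (inj₂ (leave e i 1+i≡ℓ')) (at-tgt .e .i) = stay itself z≤n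

    anchor-walk : ∀ {x y b e m} → Walk H x y m → Anchor y b e →
                  ∃₂ λ a d → Anchor x a d × ∃ λ k → Walk (Adj G) a b k × k * ℓ + d ≤ m + e
    anchor-walk [] anc = _ , _ , anc , 0 , [] , ≤-refl
    anchor-walk {e = e} {m = suc m} (s ∷ W) anc with anchor-walk W anc
    ... | a' , d' , anc' , k , V , kℓ+d'≤m+e with anchor-step s anc'
    ... | a , d , anc″ , j , U , jℓ+d≤1+d' = a , d , anc″ , j + k , U ++ʷ V , bound
      where
      open ≤-Reasoning
      bound : (j + k) * ℓ + d ≤ suc (m + e)
      bound = begin
        (j + k) * ℓ + d       ≡⟨ cong (_+ d) (*-distribʳ-+ ℓ j k) ⟩
        j * ℓ + k * ℓ + d     ≡⟨ cong (_+ d) (+-comm (j * ℓ) (k * ℓ)) ⟩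
        k * ℓ + j * ℓ + d     ≡⟨ +-assoc (k * ℓ) (j * ℓ) d ⟩
        k * ℓ + (j * ℓ + d)   ≤⟨ +-monoʳ-≤ (k * ℓ) jℓ+d≤1+d' ⟩
        k * ℓ + suc d'        ≡⟨ +-suc (k * ℓ) d' ⟩
        suc (k * ℓ + d')      ≤⟨ s≤s kℓ+d'≤m+e ⟩
        suc (m + e)           ∎

    -- Turning back would revisit the previous vertex or step outside the index range of the edge.
    ascending-reaches-tgt : ∀ {y e i xs b} → SubStep G ℓ y (inj₂ (e , i)) →
                            Chain H (inj₂ (e , i)) xs (inj₁ b) → Unique (y ∷ xs) → inj₁ (tgt G e) ∈ xs
    ascending-reaches-tgt _ (cons (inj₁ (along _ _ j j≡1+i)) rest) (_ ∷ u) =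
      there (ascending-reaches-tgt (along _ _ j j≡1+i) rest u)
    ascending-reaches-tgt _ (cons (inj₁ (leave _ _ _)) _) _ = there (here refl)
    ascending-reaches-tgt (enter _ _ _) (cons (inj₂ (enter _ _ _)) _) ((_ ∷ y≢z ∷ _) ∷ _) =
      contradiction refl y≢z
    ascending-reaches-tgt (along _ _ _ i≡1+i₀) (cons (inj₂ (enter _ _ i≡0)) _) _ =
      contradiction (trans (sym i≡0) i≡1+i₀) 0≢1+n
    ascending-reaches-tgt (enter _ _ i≡0) (cons (inj₂ (along _ _ _ i≡1+i₁)) _) _ =
      contradiction (trans (sym i≡0) i≡1+i₁) 0≢1+n
    ascending-reaches-tgt (along e _ _ i≡1+i₀) (cons (inj₂ (along _ _ _ i≡1+i₁)) _) ((_ ∷ y≢z ∷ _) ∷ _) =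
      contradiction (cong (λ k → inj₂ (e , k)) (toℕ-injective (suc-injective (trans (sym i≡1+i₀) i≡1+i₁)))) y≢z

    descending-reaches-src : ∀ {y e i xs b} → SubStep G ℓ (inj₂ (e , i)) y →
                             Chain H (inj₂ (e , i)) xs (inj₁ b) → Unique (y ∷ xs) → inj₁ (src G e) ∈ xs
    descending-reaches-src _ (cons (inj₂ (along _ i₁ _ i≡1+i₁)) rest) (_ ∷ u) =
      there (descending-reaches-src (along _ i₁ _ i≡1+i₁) rest u)
    descending-reaches-src _ (cons (inj₂ (enter _ _ _)) _) _ = there (here refl)
    descending-reaches-src (leave _ _ _) (cons (inj₁ (leave _ _ _)) _) ((_ ∷ y≢z ∷ _) ∷ _) =
      contradiction refl y≢z
    descending-reaches-src (along _ _ j₀ j₀≡1+i) (cons (inj₁ (leave _ _ 1+i≡ℓ')) _) _ =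
      contradiction (trans j₀≡1+i 1+i≡ℓ') (<⇒≢ (toℕ<n j₀))
    descending-reaches-src (leave _ _ 1+i≡ℓ') (cons (inj₁ (along _ _ j₁ j₁≡1+i)) _) _ =
      contradiction (trans j₁≡1+i 1+i≡ℓ') (<⇒≢ (toℕ<n j₁))
    descending-reaches-src (along e _ _ j₀≡1+i) (cons (inj₁ (along _ _ _ j₁≡1+i)) _) ((_ ∷ y≢z ∷ _) ∷ _) =
      contradiction (cong (λ k → inj₂ (e , k)) (toℕ-injective (trans j₀≡1+i (sym j₁≡1+i)))) y≢z

    Covered : List (SubV G ℓ) → SubV G ℓ → Set
    Covered P (inj₁ a) = inj₁ a ∈ P
    Covered P (inj₂ (e , _)) = inj₁ (src G e) ∈ P × inj₁ (tgt G e) ∈ P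

    anchor-∈ : ∀ {P x a d} → Covered P x → Anchor x a d → inj₁ a ∈ P
    anchor-∈ a∈P itself = a∈P
    anchor-∈ ends∈P (at-src _ _) = proj₁ ends∈P
    anchor-∈ ends∈P (at-tgt _ _) = proj₂ ends∈P

    covered-step : ∀ {P y x xs b} → Covered P y → H y x → Chain H x xs (inj₁ b) →
                   Unique (y ∷ xs) → xs ⊆ P → Covered P x
    covered-step _ (inj₁ (direct _ _)) ch _ xs⊆P = xs⊆P (chain-head ch)
    covered-step _ (inj₁ (leave _ _ _)) ch _ xs⊆P = xs⊆P (chain-head ch)
    covered-step _ (inj₂ (direct _ _)) ch _ xs⊆P = xs⊆P (chain-head ch)
    covered-step _ (inj₂ (enter _ _ _)) ch _ xs⊆P = xs⊆P (chain-head ch)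
    covered-step ends∈P (inj₁ (along _ _ _ _)) _ _ _ = ends∈P
    covered-step ends∈P (inj₂ (along _ _ _ _)) _ _ _ = ends∈P
    covered-step src∈P (inj₁ (enter e i i≡0)) ch u xs⊆P =
      src∈P , xs⊆P (ascending-reaches-tgt (enter e i i≡0) ch u)
    covered-step tgt∈P (inj₂ (leave e i 1+i≡ℓ')) ch u xs⊆P =
      xs⊆P (descending-reaches-src (leave e i 1+i≡ℓ') ch u) , tgt∈P

    covered-chain : ∀ {P y x xs b} → Covered P y → H y x → Chain H x xs (inj₁ b) →
                    Unique (y ∷ xs) → xs ⊆ P → All (Covered P) xs
    covered-chain cy s single u xs⊆P = covered-step cy s single u xs⊆P ∷ []
    covered-chain cy s (cons t ch) u@(_ ∷ u′) xs⊆P =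
      cx ∷ covered-chain cx t ch u′ (λ z∈ → xs⊆P (there z∈))
      where cx = covered-step cy s (cons t ch) u xs⊆P

    path-covered : ∀ {a b P} → IsPath H (inj₁ a) (inj₁ b) P → All (Covered P) P
    path-covered (single , _) = here refl ∷ []
    path-covered (cons s ch , u) = here refl ∷ covered-chain (here refl) s ch u there

    ∈-GOf : ∀ {a} P → inj₁ a ∈ P → a ∈ GOf G ℓ P
    ∈-GOf P a∈P = mapMaybe⁺ (origOf G ℓ) P (map⁺ (Any.map (λ { refl → just refl }) a∈P))

lemma11 : (G : Graph) → Connected (Adj G) →
    (ℓ : ℕ) → 1 ≤ ℓ →
    (u v : V G) (P : List (SubV G ℓ)) → IsIsometricPath (SubAdj G ℓ) (inj₁ u) (inj₁ v) P →
    (r : ℕ) → 1 ≤ r → (w : V G) →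
    (∃ λ p → p ∈ P × ∃ λ m → m < suc r * ℓ × Walk (SubAdj G ℓ) (inj₁ w) p m) →
    ∃ λ q → q ∈ GOf G ℓ P × ∃ λ m → m ≤ r × Walk (Adj G) w q m
lemma11 G _ (suc ℓ') _ _ _ P (isPath , _) r _ w (p , p∈P , m , m<[1+r]ℓ , W)
  with anchor-walk G ℓ' (walk-reverse (SubAdj-sym G ℓ') W) itself
... | a , d , anc , k , V , kℓ+d≤m+0 =
  a , ∈-GOf G ℓ' P (anchor-∈ G ℓ' (lookup (path-covered G ℓ' isPath) p∈P) anc) ,
  k , k≤r , walk-reverse (Adj-sym G) V
  where
  open ≤-Reasoning
  k≤r : k ≤ r
  k≤r = m<1+n⇒m≤n (*-cancelʳ-< (suc ℓ') k (suc r) (begin-strict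
    k * suc ℓ'      ≤⟨ m≤m+n (k * suc ℓ') d ⟩
    k * suc ℓ' + d  ≤⟨ kℓ+d≤m+0 ⟩
    m + 0           ≡⟨ +-identityʳ m ⟩
    m               <⟨ m<[1+r]ℓ ⟩
    suc r * suc ℓ'  ∎))
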